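{- Let $n\ge2$. The map $w\mapsto\mathsf{Tag}(w):=(\mathsf{Tag}_1(w),\dots,\mathsf{Tag}_{n-1}(w))\in\{0,S,C\}^{n-1}$ is a bijection from $\mathcal B_n$ onto $\mathcal T_{n-1}$.
   Context: $\mathcal B_n$ is the set of Boolean permutations in $S_n$: those admitting a reduced word in the simple transpositions $s_i=(i\ i{+}1)$ in which no $s_i$ appears more than once (then no reduced word repeats a generator). Reduced words are compared lexicographically by their index sequences; $\underline w$ denotes the lexicographically smallest reduced word of $w$. For $j\ge i$, a (decreasing) block is $s_{j\downarrow i}:=s_js_{j-1}\cdots s_i$. The maximal block factorization of $\underline w$ writes it as a concatenation of blocks chosen as large as possible (maximal runs of consecutive letters whose indices decrease by exactly $1$ at each step). For $t\in[n-1]$: $\mathsf{Pres}_t(w)=1$ if $s_t$ appears in $\underline w$, else $0$; $\mathsf{Cont}_t(w)=1$ if some block $s_{j\downarrow i}$ of the maximal block factorization of $\underline w$ contains $s_t$ and has $i<t$, else $0$. Then $\mathsf{Tag}_t(w)=0$ if $\mathsf{Pres}_t(w)=0$; $\mathsf{Tag}_t(w)=S$ if $\mathsf{Pres}_t(w)=1$ and $\mathsf{Cont}_t(w)=0$; $\mathsf{Tag}_t(w)=C$ if $\mathsf{Pres}_t(w)=\mathsf{Cont}_t(w)=1$. For $m\ge1$, $\mathcal T_m$ is the set of words $T=(T_1,\dots,T_m)\in\{0,S,C\}^m$ such that $T_1\in\{0,S\}$ and, for every $2\le r\le m$, $T_r=C$ implies $T_{r-1}\in\{S,C\}$. -}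

module Defs where

open import Data.Nat using (ℕ; zero; suc; _+_; _∸_; _≤_; _<_; pred; _≟_)
open import Data.Fin using (Fin; toℕ)
open import Data.Vec using (Vec; []; _∷_; allFin; tabulate; lookup)
open import Data.List using (List; []; _∷_; foldl; length)
open import Data.List.NonEmpty using (List⁺; [_]; _∷⁺_; head; last; toList)
open import Data.List.Relation.Unary.All using (All)
open import Data.List.Relation.Unary.Any using (Any; any?)
open import Data.List.Relation.Unary.Unique.Propositional using (Unique)
open import Data.List.Membership.Propositional using (_∈_)
open import Data.List.Membership.DecPropositional _≟_ using (_∈?_)
open import Data.Nat.Properties using (_<?_)
open import Data.Product using (Σ; ∃; _×_; _,_)
open import Data.Sum using (_⊎_)
open import Data.Bool using (if_then_else_)
open import Relation.Nullary using (Dec; yes; no; does)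
open import Relation.Nullary.Decidable using (_×-dec_)
open import Relation.Binary.PropositionalEquality using (_≡_)

-- Permutations of S_n in one-line notation: w is the vector
-- (w(1), ..., w(n)) (entries in Fin n, i.e. shifted down by one).
-- The simple transposition s_i (1 ≤ i ≤ n-1) is the letter i.
-- A word a₁ a₂ ... a_k denotes the product s_{a₁} s_{a₂} ⋯ s_{a_k};
-- right multiplication by s_i swaps positions i and i+1 of the
-- one-line notation.

swapAt : {A : Set} {m : ℕ} → ℕ → Vec A m → Vec A m
swapAt zero    (x ∷ y ∷ xs) = y ∷ x ∷ xs
swapAt (suc k) (x ∷ xs)     = x ∷ swapAt k xs
swapAt _       xs           = xs

identityPerm : (n : ℕ) → Vec (Fin n) n
identityPerm n = allFin n

prod : (n : ℕ) → List ℕ → Vec (Fin n) n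
prod n u = foldl (λ v i → swapAt (pred i) v) (identityPerm n) u

ValidLetter : ℕ → ℕ → Set
ValidLetter n i = 1 ≤ i × i < n

IsWordFor : (n : ℕ) → Vec (Fin n) n → List ℕ → Set
IsWordFor n w u = All (ValidLetter n) u × prod n u ≡ w

Reduced : (n : ℕ) → Vec (Fin n) n → List ℕ → Set
Reduced n w u = IsWordFor n w u × (∀ v → IsWordFor n w v → length u ≤ length v)

Boolean : (n : ℕ) → Vec (Fin n) n → Set
Boolean n w = Σ (List ℕ) λ u → Reduced n w u × Unique u

data _≤L_ : List ℕ → List ℕ → Set where
  []≤  : ∀ {ys} → [] ≤L ys
  here : ∀ {x y xs ys} → x < y → (x ∷ xs) ≤L (y ∷ ys)
  next : ∀ {x xs ys} → xs ≤L ys → (x ∷ xs) ≤L (x ∷ ys)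

LexMinReduced : (n : ℕ) → Vec (Fin n) n → List ℕ → Set
LexMinReduced n w u = Reduced n w u × (∀ v → Reduced n w v → u ≤L v)

-- Maximal block factorization: a block s_{j↓i} = s_j s_{j-1} ⋯ s_i is
-- represented by the nonempty list j ∷ j-1 ∷ ... ∷ i (head j, last i).

private
  merge : ℕ → List (List⁺ ℕ) → List (List⁺ ℕ)
  merge x []       = [ x ] ∷ []
  merge x (b ∷ bs) with suc (head b) ≟ x
  ... | yes _ = (x ∷⁺ b) ∷ bs
  ... | no  _ = [ x ] ∷ b ∷ bs

blocks : List ℕ → List (List⁺ ℕ)
blocks []       = []
blocks (x ∷ xs) = merge x (blocks xs)

Pres : ℕ → List ℕ → Set
Pres t u = t ∈ u

Cont : ℕ → List ℕ → Set
Cont t u = Any (λ b → t ∈ toList b × last b < t) (blocks u)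

cont? : (t : ℕ) (u : List ℕ) → Dec (Cont t u)
cont? t u = any? (λ b → (t ∈? toList b) ×-dec (last b <? t)) (blocks u)

data TagV : Set where
  𝟎 S C : TagV

tagAt : ℕ → List ℕ → TagV
tagAt t u = if does (t ∈? u) then (if does (cont? t u) then C else S) else 𝟎

tagWord : (n : ℕ) → List ℕ → Vec TagV (n ∸ 1)
tagWord n u = tabulate (λ k → tagAt (suc (toℕ k)) u)

TagOf : (n : ℕ) → Vec (Fin n) n → Vec TagV (n ∸ 1) → Set
TagOf n w T = Σ (List ℕ) λ u → LexMinReduced n w u × tagWord n u ≡ T

-- 𝒯_m : T_1 ∈ {0,S} and T_r = C ⇒ T_{r-1} ∈ {S,C}  (positions 0-based here)
InT : (m : ℕ) → Vec TagV m → Set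
InT m T =
  (∀ (k : Fin m) → toℕ k ≡ 0 → (lookup T k ≡ 𝟎 ⊎ lookup T k ≡ S)) ×
  (∀ (k k' : Fin m) → toℕ k' ≡ suc (toℕ k) → lookup T k' ≡ C →
     (lookup T k ≡ S ⊎ lookup T k ≡ C))

-- A word acts on positions through perm⁻¹, and two valid words have the same product exactly
-- when these actions agree below n. If a letter s_t occurs once in u, then u carries some
-- position below t to one at or above t; hence a word without repeated letters is reduced and
-- every word for the same permutation uses all of its letters. Commuting letters that are not
-- adjacent rearranges such a word into an increasing sequence of decreasing blocks, coded by a
-- Shape. This canonical word is the lexicographically least reduced word: a reduced word
-- starting with a smaller letter s_b would lower position b, which the canonical word raises.
-- Its blocks form its maximal block factorization, so its tags are 𝟎 in the gaps, S at the
-- bottom of each block and C above it. The tags therefore determine the shape, and every tag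
-- word in 𝒯 is decoded into a shape that produces it.
{-# OPTIONS --safe #-}
module Submission where

open import Defs
open import Data.Nat using (ℕ; zero; suc; _+_; _∸_; _≤_; _<_; pred; _≟_; z≤n; s≤s; _<?_; _≤?_; s≤s⁻¹)
open import Data.Nat.Properties
open import Data.Fin using (Fin; toℕ; fromℕ<)
import Data.Fin as Fin
open import Data.Fin.Properties using (toℕ-injective; toℕ-fromℕ<; toℕ<n)
open import Data.Vec using (Vec; []; _∷_; allFin; lookup)
open import Data.Vec.Properties using (lookup∘tabulate; tabulate∘lookup; tabulate-cong; lookup-allFin)
open import Data.Vec.Relation.Binary.Pointwise.Extensional using (ext; Pointwise-≡⇒≡)
open import Data.List using (List; []; _∷_; foldl; length; _++_; concat; map; initLast; _∷ʳ′_)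
open import Data.List.Properties using (length-++-sucʳ; ∷-injectiveˡ)
open import Data.List.NonEmpty using (List⁺; [_]; _∷⁺_; head; tail; last; toList)
open import Data.List.Relation.Unary.All as All using (All; []; _∷_)
open import Data.List.Relation.Unary.All.Properties using (++⁻ʳ) renaming (++⁺ to All-++⁺)
open import Data.List.Relation.Unary.AllPairs using ([]; _∷_)
open import Data.List.Relation.Unary.Any as Any using (Any; here; there)
import Data.List.Relation.Unary.Any.Properties as Anyₚ
open import Data.List.Relation.Unary.Unique.Propositional using (Unique)
open import Data.List.Relation.Unary.Unique.Propositional.Properties using (++⁺)
open import Data.List.Membership.Propositional using (_∈_; _∉_)
open import Data.List.Membership.Propositional.Properties
  using (∈-++⁺ˡ; ∈-++⁺ʳ; ∈-++⁻; ∈-∃++; ∈-concat⁺)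
open import Data.List.Membership.DecPropositional _≟_ using (_∈?_)
open import Data.List.Relation.Binary.Subset.Propositional using (_⊆_)
open import Data.List.Relation.Binary.Subset.Propositional.Properties using (++⁺ʳ; ⊆-reflexive-↭)
open import Data.List.Relation.Binary.Permutation.Propositional.Properties using (shift)
open import Data.Product using (Σ; ∃; _×_; _,_; proj₁; proj₂)
open import Data.Sum as Sum using (_⊎_; inj₁; inj₂)
open import Data.Empty using (⊥; ⊥-elim)
open import Data.Unit using (⊤; tt)
open import Function using (_∘_; _⇔_; mk⇔; Equivalence)
open import Relation.Nullary using (Dec; yes; no; ¬_)
open import Relation.Nullary.Decidable using (dec-true; dec-false)
open import Relation.Binary.PropositionalEquality hiding ([_])
open import Relation.Binary.Definitions using (tri<; tri≈; tri>)
open Equivalence using (to; from)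
open ≡-Reasoning

-- Words acting on positions

σ : ℕ → ℕ → ℕ
σ zero    zero          = 1
σ zero    (suc zero)    = 0
σ zero    (suc (suc x)) = suc (suc x)
σ (suc k) zero          = zero
σ (suc k) (suc x)       = suc (σ k x)

σ-involutive : ∀ k x → σ k (σ k x) ≡ x
σ-involutive zero    zero          = refl
σ-involutive zero    (suc zero)    = refl
σ-involutive zero    (suc (suc x)) = refl
σ-involutive (suc k) zero          = refl
σ-involutive (suc k) (suc x)       = cong suc (σ-involutive k x)

σ-lower : ∀ k → σ k k ≡ suc k
σ-lower zero    = refl
σ-lower (suc k) = cong suc (σ-lower k)

σ-upper : ∀ k → σ k (suc k) ≡ k
σ-upper zero    = refl
σ-upper (suc k) = cong suc (σ-upper k)

σ-fix : ∀ k x → x ≢ k → x ≢ suc k → σ k x ≡ x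
σ-fix zero    zero          x≢k _     = ⊥-elim (x≢k refl)
σ-fix zero    (suc zero)    _   x≢1+k = ⊥-elim (x≢1+k refl)
σ-fix zero    (suc (suc x)) _   _     = refl
σ-fix (suc k) zero          _   _     = refl
σ-fix (suc k) (suc x)       x≢k x≢1+k = cong suc (σ-fix k x (x≢k ∘ cong suc) (x≢1+k ∘ cong suc))

σ-comm : ∀ l k x → 2 + l ≤ k → σ k (σ l x) ≡ σ l (σ k x)
σ-comm zero    (suc zero)    x             (s≤s ())
σ-comm zero    (suc (suc k)) zero          _  = refl
σ-comm zero    (suc (suc k)) (suc zero)    _  = refl
σ-comm zero    (suc (suc k)) (suc (suc x)) _  = refl
σ-comm (suc l) (suc k)       zero          _  = refl
σ-comm (suc l) (suc k)       (suc x)       le = cong suc (σ-comm l k x (s≤s⁻¹ le))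

σ-pres-< : ∀ k m x → x < m → suc k ≢ m → σ k x < m
σ-pres-< zero    (suc zero)    zero          _   1+k≢m = ⊥-elim (1+k≢m refl)
σ-pres-< zero    (suc (suc m)) zero          _   _     = s≤s (s≤s z≤n)
σ-pres-< zero    (suc m)       (suc zero)    _   _     = s≤s z≤n
σ-pres-< zero    m             (suc (suc x)) x<m _     = x<m
σ-pres-< (suc k) m             zero          x<m _     = x<m
σ-pres-< (suc k) (suc m)       (suc x)       x<m 1+k≢m =
  s≤s (σ-pres-< k m x (s≤s⁻¹ x<m) (1+k≢m ∘ cong suc))

σ-pres-≥ : ∀ k m x → m ≤ x → suc k ≢ m → m ≤ σ k x
σ-pres-≥ k       zero          x             _   _     = z≤n
σ-pres-≥ zero    (suc zero)    x             _   1+k≢m = ⊥-elim (1+k≢m refl)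
σ-pres-≥ zero    (suc (suc m)) (suc zero)    (s≤s ()) _
σ-pres-≥ zero    (suc (suc m)) (suc (suc x)) m≤x _     = m≤x
σ-pres-≥ (suc k) (suc m)       (suc x)       m≤x 1+k≢m =
  s≤s (σ-pres-≥ k m x (s≤s⁻¹ m≤x) (1+k≢m ∘ cong suc))

-- The letter a stands for s_a, which exchanges the 0-based positions a - 1 and a
-- (matching swapAt (pred a) in prod); the junk letter 0 acts like 1.
gen : ℕ → ℕ → ℕ
gen a = σ (pred a)

perm : List ℕ → ℕ → ℕ
perm []      x = x
perm (a ∷ u) x = gen a (perm u x)

perm⁻¹ : List ℕ → ℕ → ℕ
perm⁻¹ []      x = x
perm⁻¹ (a ∷ u) x = perm⁻¹ u (gen a x)

perm⁻¹-perm : ∀ u x → perm⁻¹ u (perm u x) ≡ x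
perm⁻¹-perm []      x = refl
perm⁻¹-perm (a ∷ u) x = trans (cong (perm⁻¹ u) (σ-involutive (pred a) (perm u x))) (perm⁻¹-perm u x)

perm-perm⁻¹ : ∀ u x → perm u (perm⁻¹ u x) ≡ x
perm-perm⁻¹ []      x = refl
perm-perm⁻¹ (a ∷ u) x = trans (cong (gen a) (perm-perm⁻¹ u (gen a x))) (σ-involutive (pred a) x)

perm⁻¹-++ : ∀ u v x → perm⁻¹ (u ++ v) x ≡ perm⁻¹ v (perm⁻¹ u x)
perm⁻¹-++ []      v x = refl
perm⁻¹-++ (a ∷ u) v x = perm⁻¹-++ u v (gen a x)

Positive : List ℕ → Set
Positive = All (1 ≤_)

perm-pres-< : ∀ m u x → Positive u → m ∉ u → x < m → perm u x < m
perm-pres-< m []          x _             _   x<m = x<m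
perm-pres-< m (suc k ∷ u) x (_ ∷ pos) m∉ x<m =
  σ-pres-< k m (perm u x) (perm-pres-< m u x pos (m∉ ∘ there) x<m) (m∉ ∘ here ∘ sym)

perm⁻¹-pres-< : ∀ m u x → Positive u → m ∉ u → x < m → perm⁻¹ u x < m
perm⁻¹-pres-< m []          x _         _  x<m = x<m
perm⁻¹-pres-< m (suc k ∷ u) x (_ ∷ pos) m∉ x<m =
  perm⁻¹-pres-< m u (σ k x) pos (m∉ ∘ there) (σ-pres-< k m x x<m (m∉ ∘ here ∘ sym))

perm⁻¹-pres-≥ : ∀ m u x → Positive u → m ∉ u → m ≤ x → m ≤ perm⁻¹ u x
perm⁻¹-pres-≥ m []          x _         _  m≤x = m≤x
perm⁻¹-pres-≥ m (suc k ∷ u) x (_ ∷ pos) m∉ m≤x =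
  perm⁻¹-pres-≥ m u (σ k x) pos (m∉ ∘ there) (σ-pres-≥ k m x m≤x (m∉ ∘ here ∘ sym))

perm⁻¹-fix : ∀ u x → All (λ a → 1 ≤ a × a < x) u → perm⁻¹ u x ≡ x
perm⁻¹-fix []          x []               = refl
perm⁻¹-fix (suc k ∷ u) x ((_ , k<x) ∷ lts) = begin
  perm⁻¹ u (σ k x) ≡⟨ cong (perm⁻¹ u) (σ-fix k x (λ x≡k → <-irrefl (sym x≡k) (<-trans (n<1+n k) k<x))
                                                  (λ x≡1+k → <-irrefl (sym x≡1+k) k<x)) ⟩
  perm⁻¹ u x       ≡⟨ perm⁻¹-fix u x lts ⟩
  x                ∎

perm⁻¹-gen-comm : ∀ a u x → 1 ≤ a → All (λ c → 1 ≤ c × 1 + c < a) u →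
  perm⁻¹ u (gen a x) ≡ gen a (perm⁻¹ u x)
perm⁻¹-gen-comm a       []          x _ []                     = refl
perm⁻¹-gen-comm (suc k) (suc l ∷ u) x _ ((_ , 2+l≤1+k) ∷ far) =
  trans (cong (perm⁻¹ u) (sym (σ-comm l k x (s≤s⁻¹ 2+l≤1+k))))
        (perm⁻¹-gen-comm (suc k) u (σ l x) (s≤s z≤n) far)

lookup-swapAt : ∀ {A : Set} {m} (v : Vec A m) k (p : Fin m) → suc k < m →
  ∃ λ q → toℕ q ≡ σ k (toℕ p) × lookup (swapAt k v) p ≡ lookup v q
lookup-swapAt (x ∷ y ∷ xs) zero    Fin.zero                 _   = Fin.suc Fin.zero , refl , refl
lookup-swapAt (x ∷ y ∷ xs) zero    (Fin.suc Fin.zero)       _   = Fin.zero , refl , refl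
lookup-swapAt (x ∷ y ∷ xs) zero    (Fin.suc (Fin.suc p))    _   = Fin.suc (Fin.suc p) , refl , refl
lookup-swapAt (x ∷ [])     zero    _                        (s≤s ())
lookup-swapAt (x ∷ xs)     (suc k) Fin.zero                 _   = Fin.zero , refl , refl
lookup-swapAt (x ∷ xs)     (suc k) (Fin.suc p)              1+k<m
  with q , q≡ , lookup≡ ← lookup-swapAt xs k p (s≤s⁻¹ 1+k<m) = Fin.suc q , cong suc q≡ , lookup≡

Valid : ℕ → List ℕ → Set
Valid n = All (ValidLetter n)

Valid⇒Positive : ∀ {n u} → Valid n u → Positive u
Valid⇒Positive = All.map proj₁

Valid⇒∉ : ∀ {n u} → Valid n u → n ∉ u
Valid⇒∉ valid n∈u = <-irrefl refl (proj₂ (All.lookup valid n∈u))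

lookup-foldl-swapAt : ∀ {n} (v : Vec (Fin n) n) u (p : Fin n) → Valid n u →
  ∃ λ q → toℕ q ≡ perm u (toℕ p) × lookup (foldl (λ v i → swapAt (pred i) v) v u) p ≡ lookup v q
lookup-foldl-swapAt v []          p _                    = p , refl , refl
lookup-foldl-swapAt v (suc k ∷ u) p ((_ , 1+k<n) ∷ valid)
  with q₁ , q₁≡ , lookup≡₁ ← lookup-foldl-swapAt (swapAt k v) u p valid
  with q₂ , q₂≡ , lookup≡₂ ← lookup-swapAt v k q₁ 1+k<n
  = q₂ , trans q₂≡ (cong (σ k) q₁≡) , trans lookup≡₁ lookup≡₂

lookup-prod : ∀ n u → Valid n u → ∀ p → toℕ (lookup (prod n u) p) ≡ perm u (toℕ p)
lookup-prod n u valid p with q , q≡ , lookup≡ ← lookup-foldl-swapAt (allFin n) u p valid =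
  trans (cong toℕ (trans lookup≡ (lookup-allFin q))) q≡

_≈[_]_ : List ℕ → ℕ → List ℕ → Set
u ≈[ n ] v = ∀ x → x < n → perm⁻¹ u x ≡ perm⁻¹ v x

inverses-agree : ∀ n (f f⁻¹ g g⁻¹ : ℕ → ℕ) →
  (∀ x → f⁻¹ (f x) ≡ x) → (∀ x → g (g⁻¹ x) ≡ x) → (∀ x → x < n → g⁻¹ x < n) →
  (∀ x → x < n → f x ≡ g x) → ∀ x → x < n → f⁻¹ x ≡ g⁻¹ x
inverses-agree n f f⁻¹ g g⁻¹ f⁻¹∘f g∘g⁻¹ g⁻¹-< f≈g x x<n = begin
  f⁻¹ x           ≡⟨ cong f⁻¹ (sym (g∘g⁻¹ x)) ⟩
  f⁻¹ (g (g⁻¹ x)) ≡⟨ cong f⁻¹ (sym (f≈g (g⁻¹ x) (g⁻¹-< x x<n))) ⟩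
  f⁻¹ (f (g⁻¹ x)) ≡⟨ f⁻¹∘f (g⁻¹ x) ⟩
  g⁻¹ x           ∎

prod-≡⇒≈ : ∀ n u v → Valid n u → Valid n v → prod n u ≡ prod n v → u ≈[ n ] v
prod-≡⇒≈ n u v valid-u valid-v u≡v =
  inverses-agree n (perm u) (perm⁻¹ u) (perm v) (perm⁻¹ v) (perm⁻¹-perm u) (perm-perm⁻¹ v)
    (λ x → perm⁻¹-pres-< n v x (Valid⇒Positive valid-v) (Valid⇒∉ valid-v)) perm-agree
  where
  perm-agree : ∀ x → x < n → perm u x ≡ perm v x
  perm-agree x x<n = begin
    perm u x                                     ≡⟨ cong (perm u) (toℕ-fromℕ< x<n) ⟨
    perm u (toℕ (fromℕ< x<n))                    ≡⟨ lookup-prod n u valid-u (fromℕ< x<n) ⟨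
    toℕ (lookup (prod n u) (fromℕ< x<n))         ≡⟨ cong (λ w → toℕ (lookup w (fromℕ< x<n))) u≡v ⟩
    toℕ (lookup (prod n v) (fromℕ< x<n))         ≡⟨ lookup-prod n v valid-v (fromℕ< x<n) ⟩
    perm v (toℕ (fromℕ< x<n))                    ≡⟨ cong (perm v) (toℕ-fromℕ< x<n) ⟩
    perm v x                                     ∎

≈⇒prod-≡ : ∀ n u v → Valid n u → Valid n v → u ≈[ n ] v → prod n u ≡ prod n v
≈⇒prod-≡ n u v valid-u valid-v u≈v = Pointwise-≡⇒≡ (ext λ p → toℕ-injective (begin
  toℕ (lookup (prod n u) p) ≡⟨ lookup-prod n u valid-u p ⟩
  perm u (toℕ p)            ≡⟨ perm-agree (toℕ p) (toℕ<n p) ⟩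
  perm v (toℕ p)            ≡⟨ lookup-prod n v valid-v p ⟨
  toℕ (lookup (prod n v) p) ∎))
  where
  perm-agree : ∀ x → x < n → perm u x ≡ perm v x
  perm-agree = inverses-agree n (perm⁻¹ u) (perm u) (perm⁻¹ v) (perm v) (perm-perm⁻¹ u) (perm⁻¹-perm v)
    (λ x → perm-pres-< n v x (Valid⇒Positive valid-v) (Valid⇒∉ valid-v)) u≈v

-- Words without repeated letters

head-∉ : ∀ {a : ℕ} {u} → Unique (a ∷ u) → a ∉ u
head-∉ (a≢ ∷ _) a∈u = All.lookup a≢ a∈u refl

∈-remove : ∀ {t a : ℕ} u v → t ∈ u ++ a ∷ v → t ≢ a → t ∈ u ++ v
∈-remove []      v (here t≡a) t≢a = ⊥-elim (t≢a t≡a)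
∈-remove []      v (there t∈) _   = t∈
∈-remove (x ∷ u) v (here t≡x) _   = here t≡x
∈-remove (x ∷ u) v (there t∈) t≢a = there (∈-remove u v t∈ t≢a)

length-≤-⊆ : ∀ u v → Unique u → u ⊆ v → length u ≤ length v
length-≤-⊆ []      v _ _ = z≤n
length-≤-⊆ (a ∷ u) v unique@(_ ∷ unique-u) u⊆v with v₁ , v₂ , refl ← ∈-∃++ (u⊆v (here refl)) =
  subst (suc (length u) ≤_) (sym (length-++-sucʳ v₁ a v₂))
    (s≤s (length-≤-⊆ u (v₁ ++ v₂) unique-u
      (λ t∈u → ∈-remove v₁ v₂ (u⊆v (there t∈u)) (head-∉ unique ∘ λ t≡a → subst (_∈ u) t≡a t∈u))))

letter-crosses : ∀ u t → Unique u → Positive u → t ∈ u → ∃ λ x → x < t × t ≤ perm⁻¹ u x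
letter-crosses (suc k ∷ u) .(suc k) unique (_ ∷ pos) (here refl) =
  k , ≤-refl , subst (λ y → suc k ≤ perm⁻¹ u y) (sym (σ-lower k))
                 (perm⁻¹-pres-≥ (suc k) u (suc k) pos (head-∉ unique) ≤-refl)
letter-crosses (suc k ∷ u) t unique@(_ ∷ unique-u) (_ ∷ pos) (there t∈u)
  with x , x<t , t≤ ← letter-crosses u t unique-u pos t∈u =
  σ k x ,
  σ-pres-< k t x x<t (λ 1+k≡t → head-∉ unique (subst (_∈ u) (sym 1+k≡t) t∈u)) ,
  subst (λ y → t ≤ perm⁻¹ u y) (sym (σ-involutive k x)) t≤

letters-⊆ : ∀ n u v → Unique u → Valid n u → Valid n v → v ≈[ n ] u → u ⊆ v
letters-⊆ n u v unique valid-u valid-v v≈u {t} t∈u with t ∈? v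
... | yes t∈v = t∈v
... | no  t∉v with x , x<t , t≤ ← letter-crosses u t unique (Valid⇒Positive valid-u) t∈u =
  ⊥-elim (<-irrefl refl (<-≤-trans (subst (_< t) (v≈u x (<-trans x<t t<n)) v-below) t≤))
  where
  t<n : t < n
  t<n = proj₂ (All.lookup valid-u t∈u)
  v-below : perm⁻¹ v x < t
  v-below = perm⁻¹-pres-< t v x (Valid⇒Positive valid-v) t∉v x<t

-- Canonical words

block⁺ : ℕ → ℕ → List⁺ ℕ
block⁺ s zero    = [ s ]
block⁺ s (suc d) = s + suc d ∷⁺ block⁺ s d

block : ℕ → ℕ → List ℕ
block s d = toList (block⁺ s d)

Shape : Set
Shape = List (ℕ × ℕ)

-- A shape codes an increasing sequence of decreasing blocks: reading upwards from the
-- letter b, each pair (g , d) skips g letters and then contributes the block s_{s+d↓s}.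
mutual
  canon : ℕ → Shape → List ℕ
  canon b []            = []
  canon b ((g , d) ∷ L) = canon⁺ (b + g) d L

  canon⁺ : ℕ → ℕ → Shape → List ℕ
  canon⁺ s d L = block s d ++ canon (suc (s + d)) L

block-all : ∀ (P : ℕ → Set) s d → (∀ t → s ≤ t → t ≤ s + d → P t) → All P (block s d)
block-all P s zero    h = h s ≤-refl (m≤m+n s 0) ∷ []
block-all P s (suc d) h =
  h (s + suc d) (m≤m+n s (suc d)) ≤-refl ∷
  block-all P s d (λ t s≤t t≤ → h t s≤t (≤-trans t≤ (+-monoʳ-≤ s (n≤1+n d))))

∈-block⁻ : ∀ {t} s d → t ∈ block s d → s ≤ t × t ≤ s + d
∈-block⁻ s d = All.lookup (block-all (λ t → s ≤ t × t ≤ s + d) s d (λ _ s≤t t≤ → s≤t , t≤))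

∈-block⁺ : ∀ {t} s d → s ≤ t → t ≤ s + d → t ∈ block s d
∈-block⁺     s zero    s≤t t≤ = here (≤-antisym (≤-trans t≤ (≤-reflexive (+-identityʳ s))) s≤t)
∈-block⁺ {t} s (suc d) s≤t t≤ with t ≟ s + suc d
... | yes t≡ = here t≡
... | no  t≢ = there (∈-block⁺ s d s≤t (s≤s⁻¹ (subst (t <_) (+-suc s d) (≤∧≢⇒< t≤ t≢))))

mutual
  canon-≥ : ∀ {t} b L → t ∈ canon b L → b ≤ t
  canon-≥ b ((g , d) ∷ L) t∈ = ≤-trans (m≤m+n b g) (canon⁺-≥ (b + g) d L t∈)

  canon⁺-≥ : ∀ {t} s d L → t ∈ canon⁺ s d L → s ≤ t
  canon⁺-≥ s d L t∈ with ∈-++⁻ (block s d) t∈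
  ... | inj₁ t∈block = proj₁ (∈-block⁻ s d t∈block)
  ... | inj₂ t∈rest  = ≤-trans (m≤m+n s d) (<⇒≤ (canon-≥ (suc (s + d)) L t∈rest))

bottom∈canon⁺ : ∀ s d L → s ∈ canon⁺ s d L
bottom∈canon⁺ s d L = ∈-++⁺ˡ (∈-block⁺ s d ≤-refl (m≤m+n s d))

top∈canon⁺ : ∀ s d L → s + d ∈ canon⁺ s d L
top∈canon⁺ s d L = ∈-++⁺ˡ (∈-block⁺ s d (m≤m+n s d) ≤-refl)

canon-above : ∀ s d L → All (s + d <_) (canon (suc (s + d)) L)
canon-above s d L = All.tabulate (canon-≥ (suc (s + d)) L)

block-unique : ∀ s d → Unique (block s d)
block-unique s zero    = [] ∷ []
block-unique s (suc d) =
  block-all (s + suc d ≢_) s d (λ t _ t≤ t≡ → <-irrefl (sym t≡) (≤-<-trans t≤ (+-monoʳ-< s (n<1+n d)))) ∷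
  block-unique s d

canon-unique : ∀ b L → Unique (canon b L)
canon-unique b []            = []
canon-unique b ((g , d) ∷ L) = ++⁺ (block-unique (b + g) d) (canon-unique (suc (b + g + d)) L)
  (λ (t∈block , t∈rest) →
     <-irrefl refl (≤-<-trans (proj₂ (∈-block⁻ (b + g) d t∈block)) (canon-≥ (suc (b + g + d)) L t∈rest)))

perm⁻¹-block : ∀ s e c → 1 ≤ s → s ≤ c → c < s + e → perm⁻¹ (block s e) c ≡ suc c
perm⁻¹-block s zero    c _   s≤c c< =
  ⊥-elim (<-irrefl refl (≤-<-trans s≤c (subst (c <_) (+-identityʳ s) c<)))
perm⁻¹-block s (suc e) c 1≤s s≤c c< with c ≟ s + e | cong pred (+-suc s e)
... | yes refl | pred≡ = begin
  perm⁻¹ (block s e) (σ (pred (s + suc e)) (s + e)) ≡⟨ cong (λ k → perm⁻¹ (block s e) (σ k (s + e))) pred≡ ⟩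
  perm⁻¹ (block s e) (σ (s + e) (s + e))            ≡⟨ cong (perm⁻¹ (block s e)) (σ-lower (s + e)) ⟩
  perm⁻¹ (block s e) (suc (s + e))                  ≡⟨ perm⁻¹-fix (block s e) (suc (s + e)) below ⟩
  suc (s + e)                                       ∎
  where
  below : All (λ a → 1 ≤ a × a < suc (s + e)) (block s e)
  below = block-all _ s e (λ _ s≤t t≤ → ≤-trans 1≤s s≤t , s≤s t≤)
... | no c≢ | pred≡ = begin
  perm⁻¹ (block s e) (σ (pred (s + suc e)) c) ≡⟨ cong (λ k → perm⁻¹ (block s e) (σ k c)) pred≡ ⟩
  perm⁻¹ (block s e) (σ (s + e) c)            ≡⟨ cong (perm⁻¹ (block s e)) (σ-fix (s + e) c c≢ c≢1+s+e) ⟩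
  perm⁻¹ (block s e) c                        ≡⟨ perm⁻¹-block s e c 1≤s s≤c c<s+e ⟩
  suc c                                       ∎
  where
  c<′ : c < suc (s + e)
  c<′ = subst (c <_) (+-suc s e) c<
  c≢1+s+e : c ≢ suc (s + e)
  c≢1+s+e c≡ = <-irrefl c≡ c<′
  c<s+e : c < s + e
  c<s+e = ≤∧≢⇒< (s≤s⁻¹ c<′) c≢

Rearranges : List ℕ → List ℕ → Set
Rearranges u v = perm⁻¹ u ≗ perm⁻¹ v × u ⊆ v

≡⇒Rearranges : ∀ {u v} → u ≡ v → Rearranges u v
≡⇒Rearranges refl = (λ _ → refl) , λ t∈ → t∈

Rearranges-trans : ∀ {u v w} → Rearranges u v → Rearranges v w → Rearranges u w
Rearranges-trans (u≗v , u⊆v) (v≗w , v⊆w) = (λ x → trans (u≗v x) (v≗w x)) , v⊆w ∘ u⊆v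

Rearranges-++ˡ : ∀ w {u v} → Rearranges u v → Rearranges (w ++ u) (w ++ v)
Rearranges-++ˡ w {u} {v} (u≗v , u⊆v) =
  (λ x → trans (perm⁻¹-++ w u x) (trans (u≗v (perm⁻¹ w x)) (sym (perm⁻¹-++ w v x)))) , ++⁺ʳ w u⊆v

commute-to-front : ∀ a w v → 1 ≤ a → All (λ c → 1 ≤ c × 1 + c < a) w →
  Rearranges (w ++ a ∷ v) (a ∷ w ++ v)
commute-to-front a w v 1≤a far = same-perm , ⊆-reflexive-↭ (shift a w v)
  where
  same-perm : perm⁻¹ (w ++ a ∷ v) ≗ perm⁻¹ (a ∷ w ++ v)
  same-perm x = begin
    perm⁻¹ (w ++ a ∷ v) x          ≡⟨ perm⁻¹-++ w (a ∷ v) x ⟩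
    perm⁻¹ v (gen a (perm⁻¹ w x))  ≡⟨ cong (perm⁻¹ v) (perm⁻¹-gen-comm a w x 1≤a far) ⟨
    perm⁻¹ v (perm⁻¹ w (gen a x))  ≡⟨ perm⁻¹-++ w v (gen a x) ⟨
    perm⁻¹ (a ∷ w ++ v) x          ∎

narrowGap : Shape → Shape
narrowGap []            = []
narrowGap ((g , d) ∷ L) = (pred g , d) ∷ L

canon-narrowGap : ∀ b L → b ∉ canon b L → canon (suc b) (narrowGap L) ≡ canon b L
canon-narrowGap b []                  _   = refl
canon-narrowGap b ((zero , d) ∷ L)    b∉  =
  ⊥-elim (b∉ (subst (_∈ canon b ((0 , d) ∷ L)) (+-identityʳ b) (bottom∈canon⁺ (b + 0) d L)))
canon-narrowGap b ((suc g , d) ∷ L)   _   = cong (λ s → canon⁺ s d L) (sym (+-suc b g))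

-- Putting s_a in front of canon b L: s_a opens a block of its own in a gap, extends
-- upwards the block ending at s_{a-1}, or commutes past a block lying below s_{a-1}.
insert : ℕ → ℕ → Shape → Shape
insert a b []            = (a ∸ b , 0) ∷ []
insert a b ((g , d) ∷ L) with a <? b + g | a ≟ suc (b + g + d)
... | yes _ | _     = (a ∸ b , 0) ∷ (b + g ∸ suc a , d) ∷ L
... | no _  | yes _ = (g , suc d) ∷ narrowGap L
... | no _  | no _  = (g , d) ∷ insert a (suc (b + g + d)) L

insert-rearranges : ∀ a b L → 1 ≤ b → b ≤ a → a ∉ canon b L →
  Rearranges (canon b (insert a b L)) (a ∷ canon b L)
insert-rearranges a b [] _ b≤a _ = ≡⇒Rearranges (cong (_∷ []) (m+[n∸m]≡n b≤a))
insert-rearranges a b ((g , d) ∷ L) 1≤b b≤a a∉ with a <? b + g | a ≟ suc (b + g + d)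
... | yes a<s | _ = ≡⇒Rearranges (cong₂ (λ x y → x ∷ canon⁺ y d L) (m+[n∸m]≡n b≤a) next-start)
  where
  next-start : suc (b + (a ∸ b) + 0) + (b + g ∸ suc a) ≡ b + g
  next-start = trans (cong (λ x → suc x + (b + g ∸ suc a)) (trans (+-identityʳ _) (m+[n∸m]≡n b≤a)))
                     (m+[n∸m]≡n a<s)
... | no _ | yes refl = ≡⇒Rearranges (cong₂ (λ x y → x ∷ block (b + g) d ++ y) (+-suc (b + g) d)
  (trans (cong (λ x → canon (suc x) (narrowGap L)) (+-suc (b + g) d))
         (canon-narrowGap (suc (b + g + d)) L (a∉ ∘ ∈-++⁺ʳ (block (b + g) d)))))
... | no a≮s | no a≢ = Rearranges-trans
  (Rearranges-++ˡ (block s d)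
    (insert-rearranges a (suc (s + d)) L (s≤s z≤n) s+d<a (a∉ ∘ ∈-++⁺ʳ (block s d))))
  (commute-to-front a (block s d) (canon (suc (s + d)) L) (≤-trans 1≤b b≤a) far)
  where
  s : ℕ
  s = b + g
  s+d<a : s + d < a
  s+d<a with ≤-<-connex a (s + d)
  ... | inj₁ a≤ = ⊥-elim (a∉ (∈-++⁺ˡ (∈-block⁺ s d (≮⇒≥ a≮s) a≤)))
  ... | inj₂ s+d<a = s+d<a
  far : All (λ c → 1 ≤ c × 1 + c < a) (block s d)
  far = block-all _ s d (λ _ s≤t t≤ →
    ≤-trans (≤-trans 1≤b (m≤m+n b g)) s≤t , ≤-<-trans (s≤s t≤) (≤∧≢⇒< s+d<a (a≢ ∘ sym)))

canonical-form : ∀ z → Unique z → Positive z → ∃ λ L → Rearranges (canon 1 L) z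
canonical-form []      _                    _           = [] , ≡⇒Rearranges refl
canonical-form (a ∷ z) unique@(_ ∷ unique-z) (1≤a ∷ pos)
  with L , rearranges ← canonical-form z unique-z pos =
  insert a 1 L , Rearranges-trans (insert-rearranges a 1 L ≤-refl 1≤a (head-∉ unique ∘ proj₂ rearranges))
                                  (Rearranges-++ˡ (a ∷ []) rearranges)


-- Lexicographic minimality

-- Each letter b occurring after a larger letter a is lifted by the suffix starting at a;
-- this is what rules out a reduced word for the same permutation starting with such a b.
Lifting : List ℕ → Set
Lifting []      = ⊤
Lifting (a ∷ u) = (∀ b → b ∈ u → b < a → b < perm⁻¹ (a ∷ u) b) × Lifting u

block-++-lifting : ∀ s d R → 1 ≤ s → All (s + d <_) R → Lifting R → Lifting (block s d ++ R)
block-++-lifting s zero    R _   above lifting-R =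
  (λ c c∈R c<s → ⊥-elim (<-asym c<s (≤-<-trans (m≤m+n s 0) (All.lookup above c∈R)))) , lifting-R
block-++-lifting s (suc d) R 1≤s above lifting-R =
  lifts , block-++-lifting s d R 1≤s (All.map (<-trans (+-monoʳ-< s (n<1+n d))) above) lifting-R
  where
  lifts : ∀ c → c ∈ block s d ++ R → c < s + suc d → c < perm⁻¹ (block s (suc d) ++ R) c
  lifts c c∈ c< with ∈-++⁻ (block s d) c∈
  ... | inj₂ c∈R     = ⊥-elim (<-irrefl refl (<-trans c< (All.lookup above c∈R)))
  ... | inj₁ c∈block = subst (c <_) (sym moved) (perm⁻¹-pres-≥ (suc c) R (suc c) positive-R c+1∉R ≤-refl)
    where
    moved : perm⁻¹ (block s (suc d) ++ R) c ≡ perm⁻¹ R (suc c)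
    moved = trans (perm⁻¹-++ (block s (suc d)) R c)
                  (cong (perm⁻¹ R) (perm⁻¹-block s (suc d) c 1≤s (proj₁ (∈-block⁻ s d c∈block)) c<))
    positive-R : Positive R
    positive-R = All.map (λ s+d+1<x → ≤-trans 1≤s (≤-trans (m≤m+n s (suc d)) (<⇒≤ s+d+1<x))) above
    c+1∉R : suc c ∉ R
    c+1∉R c+1∈R = <-irrefl refl (≤-<-trans c< (All.lookup above c+1∈R))

canon-lifting : ∀ b L → 1 ≤ b → Lifting (canon b L)
canon-lifting b []            _   = tt
canon-lifting b ((g , d) ∷ L) 1≤b = block-++-lifting (b + g) d (canon (suc (b + g + d)) L)
  (≤-trans 1≤b (m≤m+n b g)) (canon-above (b + g) d L) (canon-lifting (suc (b + g + d)) L (s≤s z≤n))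

≈-tail : ∀ n a u v → ValidLetter n a → (a ∷ u) ≈[ n ] (a ∷ v) → u ≈[ n ] v
≈-tail n (suc k) u v (_ , 1+k<n) a∷u≈a∷v x x<n = begin
  perm⁻¹ u x             ≡⟨ cong (perm⁻¹ u) (σ-involutive k x) ⟨
  perm⁻¹ u (σ k (σ k x)) ≡⟨ a∷u≈a∷v (σ k x) (σ-pres-< k n x x<n (λ 1+k≡n → <-irrefl 1+k≡n 1+k<n)) ⟩
  perm⁻¹ v (σ k (σ k x)) ≡⟨ cong (perm⁻¹ v) (σ-involutive k x) ⟩
  perm⁻¹ v x             ∎

smaller-letter-not-first : ∀ n a u b v →
  Lifting (a ∷ u) → Unique (a ∷ u) → Valid n (a ∷ u) → Valid n (b ∷ v) →
  (b ∷ v) ≈[ n ] (a ∷ u) → length v ≤ length u → b < a → ⊥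
smaller-letter-not-first n a u (suc k) v lifting unique valid-u valid-v@((_ , b<n) ∷ valid-v′) v≈u len b<a =
  decide (b ∈? v) (b ∈? u)
  where
  b : ℕ
  b = suc k
  b∷v⊇a∷u : a ∷ u ⊆ b ∷ v
  b∷v⊇a∷u = letters-⊆ n (a ∷ u) (b ∷ v) unique valid-u valid-v v≈u
  v⊇a∷u : b ∈ v ⊎ b ∉ u → a ∷ u ⊆ v
  v⊇a∷u b∈v⊎b∉u {t} t∈a∷u with b∷v⊇a∷u t∈a∷u | t∈a∷u | b∈v⊎b∉u
  ... | there t∈v | _         | _        = t∈v
  ... | here refl | _         | inj₁ b∈v = b∈v
  ... | here refl | here refl | inj₂ _   = ⊥-elim (<-irrefl refl b<a)
  ... | here refl | there b∈u | inj₂ b∉u = ⊥-elim (b∉u b∈u)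
  too-long : a ∷ u ⊆ v → ⊥
  too-long a∷u⊆v = <-irrefl refl (≤-<-trans (length-≤-⊆ (a ∷ u) v unique a∷u⊆v) (s≤s len))
  lowered : b ∉ v → perm⁻¹ (b ∷ v) b < b
  lowered b∉v = subst (λ y → perm⁻¹ v y < b) (sym (σ-upper k))
    (perm⁻¹-pres-< b v k (Valid⇒Positive valid-v′) b∉v ≤-refl)
  decide : Dec (b ∈ v) → Dec (b ∈ u) → ⊥
  decide (yes b∈v) _         = too-long (v⊇a∷u (inj₁ b∈v))
  decide (no  _)   (no b∉u)  = too-long (v⊇a∷u (inj₂ b∉u))
  decide (no  b∉v) (yes b∈u) =
    <-irrefl refl (<-trans (proj₁ lifting b b∈u b<a) (subst (_< b) (v≈u b b<n) (lowered b∉v)))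

lifting⇒≤L : ∀ n u v → Lifting u → Unique u → Valid n u → Valid n v → v ≈[ n ] u →
  length v ≤ length u → u ≤L v
lifting⇒≤L n []      v       _ _ _ _ _ _ = []≤
lifting⇒≤L n (a ∷ u) []      _ unique valid-u valid-v v≈u _
  with () ← letters-⊆ n (a ∷ u) [] unique valid-u valid-v v≈u (here refl)
lifting⇒≤L n (a ∷ u) (b ∷ v) lifting unique@(_ ∷ unique-u) valid-u@(valid-a ∷ valid-u′) valid-v@(_ ∷ valid-v′)
  v≈u (s≤s len)
  with <-cmp a b
... | tri< a<b _ _ = here a<b
... | tri≈ _ refl _ =
  next (lifting⇒≤L n u v (proj₂ lifting) unique-u valid-u′ valid-v′ (≈-tail n a v u valid-a v≈u) len)
... | tri> _ _ b<a = ⊥-elim (smaller-letter-not-first n a u b v lifting unique valid-u valid-v v≈u len b<a)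

≤L-antisym : ∀ {u v} → u ≤L v → v ≤L u → u ≡ v
≤L-antisym []≤      []≤      = refl
≤L-antisym (here p) (here q) = ⊥-elim (<-asym p q)
≤L-antisym (here p) (next _) = ⊥-elim (<-irrefl refl p)
≤L-antisym (next _) (here q) = ⊥-elim (<-irrefl refl q)
≤L-antisym (next p) (next q) = cong (_ ∷_) (≤L-antisym p q)

canon-LexMinReduced : ∀ n L → Valid n (canon 1 L) → LexMinReduced n (prod n (canon 1 L)) (canon 1 L)
canon-LexMinReduced n L valid = ((valid , refl) , shortest) , lexMin
  where
  c : List ℕ
  c = canon 1 L
  unique : Unique c
  unique = canon-unique 1 L
  shortest : ∀ v → IsWordFor n (prod n c) v → length c ≤ length v
  shortest v (valid-v , v≡c) =
    length-≤-⊆ c v unique (letters-⊆ n c v unique valid valid-v (prod-≡⇒≈ n v c valid-v valid v≡c))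
  lexMin : ∀ v → Reduced n (prod n c) v → c ≤L v
  lexMin v ((valid-v , v≡c) , v-shortest) =
    lifting⇒≤L n c v (canon-lifting 1 L ≤-refl) unique valid valid-v (prod-≡⇒≈ n v c valid-v valid v≡c)
      (v-shortest c (valid , refl))

LexMinReduced-unique : ∀ n w u v → LexMinReduced n w u → LexMinReduced n w v → u ≡ v
LexMinReduced-unique n w u v (reduced-u , u-min) (reduced-v , v-min) =
  ≤L-antisym (u-min v reduced-v) (v-min u reduced-u)

Boolean⇒lexMin-canon : ∀ n w → Boolean n w → ∃ λ L → LexMinReduced n w (canon 1 L)
Boolean⇒lexMin-canon n w (z , ((valid-z , z↦w) , _) , unique)
  with L , (≗z , ⊆z) ← canonical-form z unique (Valid⇒Positive valid-z) =
  L , subst (λ w → LexMinReduced n w (canon 1 L)) L↦w (canon-LexMinReduced n L valid)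
  where
  valid : Valid n (canon 1 L)
  valid = All.tabulate (All.lookup valid-z ∘ ⊆z)
  L↦w : prod n (canon 1 L) ≡ w
  L↦w = trans (≈⇒prod-≡ n (canon 1 L) z valid valid-z (λ x _ → ≗z x)) z↦w

-- Maximal block factorization and tags

last-∷⁺ : ∀ (x : ℕ) b → last (x ∷⁺ b) ≡ last b
last-∷⁺ x b with initLast (tail b)
... | []       = refl
... | _ ∷ʳ′ _  = refl

last-block⁺ : ∀ s d → last (block⁺ s d) ≡ s
last-block⁺ s zero    = refl
last-block⁺ s (suc d) = trans (last-∷⁺ (s + suc d) (block⁺ s d)) (last-block⁺ s d)

head-block⁺ : ∀ s d → head (block⁺ s d) ≡ s + d
head-block⁺ s zero    = sym (+-identityʳ s)
head-block⁺ s (suc d) = refl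

blocks-concat : ∀ u → concat (map toList (blocks u)) ≡ u
blocks-concat []       = refl
blocks-concat (x ∷ xs) with blocks xs | blocks-concat xs
... | []     | refl = refl
... | b ∷ bs | ≡xs with suc (head b) ≟ x
...   | yes _ = cong (x ∷_) ≡xs
...   | no  _ = cong (x ∷_) ≡xs

blocks-block-++ : ∀ s d R → All (s + d <_) R → blocks (block s d ++ R) ≡ block⁺ s d ∷ blocks R
blocks-block-++ s zero []      _ = refl
blocks-block-++ s zero (r ∷ R) (s+0<r ∷ _) with blocks (r ∷ R) | blocks-concat (r ∷ R)
... | b ∷ bs | concat≡ with suc (head b) ≟ s
...   | yes 1+h≡s = ⊥-elim (<-asym s+0<r (<-≤-trans r<s (m≤m+n s 0)))
  where
  r<s : r < s
  r<s = subst (_< s) (∷-injectiveˡ concat≡) (subst (head b <_) 1+h≡s (n<1+n (head b)))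
...   | no  _     = refl
blocks-block-++ s (suc d) R above
  rewrite blocks-block-++ s d R (All.map (<-trans (+-monoʳ-< s (n<1+n d))) above)
  with suc (head (block⁺ s d)) ≟ s + suc d
... | yes _     = refl
... | no  1+h≢ = ⊥-elim (1+h≢ (trans (cong suc (head-block⁺ s d)) (sym (+-suc s d))))

Cont-block-++ : ∀ t s d R → All (s + d <_) R →
  Cont t (block s d ++ R) ⇔ ((t ∈ block s d × s < t) ⊎ Cont t R)
Cont-block-++ t s d R above =
  mk⇔ (split ∘ subst (Any Q) (blocks-block-++ s d R above))
      (subst (Any Q) (sym (blocks-block-++ s d R above)) ∘ join)
  where
  Q : List⁺ ℕ → Set
  Q b = t ∈ toList b × last b < t
  split : Any Q (block⁺ s d ∷ blocks R) → (t ∈ block s d × s < t) ⊎ Cont t R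
  split (here (t∈ , last<t)) = inj₁ (t∈ , subst (_< t) (last-block⁺ s d) last<t)
  split (there cont)        = inj₂ cont
  join : (t ∈ block s d × s < t) ⊎ Cont t R → Any Q (block⁺ s d ∷ blocks R)
  join (inj₁ (t∈ , s<t)) = here (t∈ , subst (_< t) (sym (last-block⁺ s d)) s<t)
  join (inj₂ cont)       = there cont

Cont⇒∈ : ∀ t u → Cont t u → t ∈ u
Cont⇒∈ t u cont = subst (t ∈_) (blocks-concat u) (∈-concat⁺ (Anyₚ.map⁺ (Any.map proj₁ cont)))

tagAt-𝟎 : ∀ t u → t ∉ u → tagAt t u ≡ 𝟎
tagAt-𝟎 t u t∉u rewrite dec-false (t ∈? u) t∉u = refl

tagAt-S : ∀ t u → t ∈ u → ¬ Cont t u → tagAt t u ≡ S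
tagAt-S t u t∈u ¬cont rewrite dec-true (t ∈? u) t∈u | dec-false (cont? t u) ¬cont = refl

tagAt-C : ∀ t u → t ∈ u → Cont t u → tagAt t u ≡ C
tagAt-C t u t∈u cont rewrite dec-true (t ∈? u) t∈u | dec-true (cont? t u) cont = refl

tagAt-cong : ∀ t u v → (t ∈ u ⇔ t ∈ v) → (Cont t u ⇔ Cont t v) → tagAt t u ≡ tagAt t v
tagAt-cong t u v ∈⇔ cont⇔ = decide (t ∈? v) (cont? t v)
  where
  decide : Dec (t ∈ v) → Dec (Cont t v) → tagAt t u ≡ tagAt t v
  decide (no  t∉v) _          = trans (tagAt-𝟎 t u (t∉v ∘ to ∈⇔)) (sym (tagAt-𝟎 t v t∉v))
  decide (yes t∈v) (no ¬cont) =
    trans (tagAt-S t u (from ∈⇔ t∈v) (¬cont ∘ to cont⇔)) (sym (tagAt-S t v t∈v ¬cont))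
  decide (yes t∈v) (yes cont) =
    trans (tagAt-C t u (from ∈⇔ t∈v) (from cont⇔ cont)) (sym (tagAt-C t v t∈v cont))

mutual
  shapeTag : ℕ → Shape → ℕ → TagV
  shapeTag b []            t = 𝟎
  shapeTag b ((g , d) ∷ L) t = shapeTag⁺ (b + g) d L t

  shapeTag⁺ : ℕ → ℕ → Shape → ℕ → TagV
  shapeTag⁺ s d L t with t <? s | t ≟ s | t ≤? s + d
  ... | yes _ | _     | _     = 𝟎
  ... | no _  | yes _ | _     = S
  ... | no _  | no _  | yes _ = C
  ... | no _  | no _  | no _  = shapeTag (suc (s + d)) L t

shapeTag⁺-below : ∀ s d L t → t < s → shapeTag⁺ s d L t ≡ 𝟎
shapeTag⁺-below s d L t t<s with t <? s | t ≟ s | t ≤? s + d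
... | yes _ | _ | _ = refl
... | no t≮s | _ | _ = ⊥-elim (t≮s t<s)

shapeTag⁺-bottom : ∀ s d L → shapeTag⁺ s d L s ≡ S
shapeTag⁺-bottom s d L with s <? s | s ≟ s | s ≤? s + d
... | yes s<s | _       | _ = ⊥-elim (<-irrefl refl s<s)
... | no _    | yes _   | _ = refl
... | no _    | no s≢s  | _ = ⊥-elim (s≢s refl)

shapeTag⁺-inside : ∀ s d L t → s < t → t ≤ s + d → shapeTag⁺ s d L t ≡ C
shapeTag⁺-inside s d L t s<t t≤ with t <? s | t ≟ s | t ≤? s + d
... | yes t<s | _      | _      = ⊥-elim (<-asym s<t t<s)
... | no _    | yes t≡ | _      = ⊥-elim (<-irrefl (sym t≡) s<t)
... | no _    | no _   | yes _  = refl
... | no _    | no _   | no t≰  = ⊥-elim (t≰ t≤)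

shapeTag⁺-above : ∀ s d L t → s + d < t → shapeTag⁺ s d L t ≡ shapeTag (suc (s + d)) L t
shapeTag⁺-above s d L t s+d<t with t <? s | t ≟ s | t ≤? s + d
... | yes t<s | _      | _     = ⊥-elim (<-asym t<s (≤-<-trans (m≤m+n s d) s+d<t))
... | no _    | yes t≡ | _     = ⊥-elim (<-irrefl (sym t≡) (≤-<-trans (m≤m+n s d) s+d<t))
... | no _    | no _   | yes t≤ = ⊥-elim (<-irrefl refl (≤-<-trans t≤ s+d<t))
... | no _    | no _   | no _  = refl

shapeTag-below : ∀ b L t → t < b → shapeTag b L t ≡ 𝟎
shapeTag-below b []            t _   = refl
shapeTag-below b ((g , d) ∷ L) t t<b = shapeTag⁺-below (b + g) d L t (<-≤-trans t<b (m≤m+n b g))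

tagAt-canon⁺-below : ∀ s d L t → t < s → tagAt t (canon⁺ s d L) ≡ 𝟎
tagAt-canon⁺-below s d L t t<s =
  tagAt-𝟎 t (canon⁺ s d L) (λ t∈ → <-irrefl refl (<-≤-trans t<s (canon⁺-≥ s d L t∈)))

tagAt-canon⁺-bottom : ∀ s d L → tagAt s (canon⁺ s d L) ≡ S
tagAt-canon⁺-bottom s d L =
  tagAt-S s (canon⁺ s d L) (bottom∈canon⁺ s d L) (not-cont ∘ to (Cont-block-++ s s d R above))
  where
  R : List ℕ
  R = canon (suc (s + d)) L
  above : All (s + d <_) R
  above = canon-above s d L
  not-cont : ¬ ((s ∈ block s d × s < s) ⊎ Cont s R)
  not-cont (inj₁ (_ , s<s)) = <-irrefl refl s<s
  not-cont (inj₂ cont)      = <-irrefl refl (≤-<-trans (m≤m+n s d) (All.lookup above (Cont⇒∈ s R cont)))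

tagAt-canon⁺-inside : ∀ s d L t → s < t → t ≤ s + d → tagAt t (canon⁺ s d L) ≡ C
tagAt-canon⁺-inside s d L t s<t t≤ = tagAt-C t (canon⁺ s d L) (∈-++⁺ˡ t∈block)
  (from (Cont-block-++ t s d (canon (suc (s + d)) L) (canon-above s d L)) (inj₁ (t∈block , s<t)))
  where
  t∈block : t ∈ block s d
  t∈block = ∈-block⁺ s d (<⇒≤ s<t) t≤

tagAt-canon⁺-above : ∀ s d L t → s + d < t → tagAt t (canon⁺ s d L) ≡ tagAt t (canon (suc (s + d)) L)
tagAt-canon⁺-above s d L t s+d<t = tagAt-cong t (canon⁺ s d L) R (mk⇔ ∈-rest (∈-++⁺ʳ (block s d))) cont⇔
  where
  R : List ℕ
  R = canon (suc (s + d)) L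
  t∉block : t ∉ block s d
  t∉block t∈block = <-irrefl refl (≤-<-trans (proj₂ (∈-block⁻ s d t∈block)) s+d<t)
  ∈-rest : t ∈ canon⁺ s d L → t ∈ R
  ∈-rest t∈ with ∈-++⁻ (block s d) t∈
  ... | inj₁ t∈block = ⊥-elim (t∉block t∈block)
  ... | inj₂ t∈R     = t∈R
  cont-rest : (t ∈ block s d × s < t) ⊎ Cont t R → Cont t R
  cont-rest (inj₁ (t∈block , _)) = ⊥-elim (t∉block t∈block)
  cont-rest (inj₂ cont)          = cont
  cont⇔ : Cont t (canon⁺ s d L) ⇔ Cont t R
  cont⇔ = mk⇔ (cont-rest ∘ to (Cont-block-++ t s d R (canon-above s d L)))
              (from (Cont-block-++ t s d R (canon-above s d L)) ∘ inj₂)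

mutual
  tagAt-canon : ∀ b L t → tagAt t (canon b L) ≡ shapeTag b L t
  tagAt-canon b []            t = tagAt-𝟎 t [] λ ()
  tagAt-canon b ((g , d) ∷ L) t = tagAt-canon⁺ (b + g) d L t

  tagAt-canon⁺ : ∀ s d L t → tagAt t (canon⁺ s d L) ≡ shapeTag⁺ s d L t
  tagAt-canon⁺ s d L t with <-cmp t s
  ... | tri< t<s _ _  = trans (tagAt-canon⁺-below s d L t t<s) (sym (shapeTag⁺-below s d L t t<s))
  ... | tri≈ _ refl _ = trans (tagAt-canon⁺-bottom t d L) (sym (shapeTag⁺-bottom t d L))
  ... | tri> _ _ s<t with ≤-<-connex t (s + d)
  ...   | inj₁ t≤    = trans (tagAt-canon⁺-inside s d L t s<t t≤) (sym (shapeTag⁺-inside s d L t s<t t≤))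
  ...   | inj₂ s+d<t = begin
    tagAt t (canon⁺ s d L)          ≡⟨ tagAt-canon⁺-above s d L t s+d<t ⟩
    tagAt t (canon (suc (s + d)) L) ≡⟨ tagAt-canon (suc (s + d)) L t ⟩
    shapeTag (suc (s + d)) L t      ≡⟨ shapeTag⁺-above s d L t s+d<t ⟨
    shapeTag⁺ s d L t               ∎

mutual
  shapeTag-C⇒> : ∀ b L t → shapeTag b L t ≡ C → b < t
  shapeTag-C⇒> b ((g , d) ∷ L) t C≡ = ≤-<-trans (m≤m+n b g) (shapeTag⁺-C⇒> (b + g) d L t C≡)

  shapeTag⁺-C⇒> : ∀ s d L t → shapeTag⁺ s d L t ≡ C → s < t
  shapeTag⁺-C⇒> s d L t C≡ with <-cmp t s
  ... | tri< t<s _ _  with () ← trans (sym (shapeTag⁺-below s d L t t<s)) C≡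
  ... | tri≈ _ refl _ with () ← trans (sym (shapeTag⁺-bottom t d L)) C≡
  ... | tri> _ _ s<t  = s<t

shapeTag-base≢C : ∀ b L → shapeTag b L b ≢ C
shapeTag-base≢C b L C≡ = <-irrefl refl (shapeTag-C⇒> b L b C≡)

mutual
  shapeTag-C⇒pred : ∀ b L t → shapeTag b L (suc t) ≡ C → shapeTag b L t ≡ S ⊎ shapeTag b L t ≡ C
  shapeTag-C⇒pred b ((g , d) ∷ L) t C≡ = shapeTag⁺-C⇒pred (b + g) d L t C≡

  shapeTag⁺-C⇒pred : ∀ s d L t → shapeTag⁺ s d L (suc t) ≡ C →
    shapeTag⁺ s d L t ≡ S ⊎ shapeTag⁺ s d L t ≡ C
  shapeTag⁺-C⇒pred s d L t C≡ with <-cmp t s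
  ... | tri< t<s _ _  = ⊥-elim (<-irrefl refl (<-≤-trans t<s (s≤s⁻¹ (shapeTag⁺-C⇒> s d L (suc t) C≡))))
  ... | tri≈ _ refl _ = inj₁ (shapeTag⁺-bottom t d L)
  ... | tri> _ _ s<t with ≤-<-connex (suc t) (s + d)
  ...   | inj₁ 1+t≤    = inj₂ (shapeTag⁺-inside s d L t s<t (≤-trans (n≤1+n t) 1+t≤))
  ...   | inj₂ s+d<1+t = Sum.map (trans (shapeTag⁺-above s d L t s+d<t)) (trans (shapeTag⁺-above s d L t s+d<t))
                                 (shapeTag-C⇒pred (suc (s + d)) L t C≡′)
    where
    C≡′ : shapeTag (suc (s + d)) L (suc t) ≡ C
    C≡′ = trans (sym (shapeTag⁺-above s d L (suc t) s+d<1+t)) C≡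
    s+d<t : s + d < t
    s+d<t = s≤s⁻¹ (shapeTag-C⇒> (suc (s + d)) L (suc t) C≡′)

lookup-tagWord-canon : ∀ n L k → lookup (tagWord n (canon 1 L)) k ≡ shapeTag 1 L (suc (toℕ k))
lookup-tagWord-canon n L k = trans (lookup∘tabulate _ k) (tagAt-canon 1 L (suc (toℕ k)))

≢C⇒𝟎⊎S : ∀ x → x ≢ C → x ≡ 𝟎 ⊎ x ≡ S
≢C⇒𝟎⊎S 𝟎 _   = inj₁ refl
≢C⇒𝟎⊎S S _   = inj₂ refl
≢C⇒𝟎⊎S C x≢C = ⊥-elim (x≢C refl)

tagWord-canon-∈𝒯 : ∀ n L → InT (n ∸ 1) (tagWord n (canon 1 L))
tagWord-canon-∈𝒯 n L = first , after-C
  where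
  tag≡ : ∀ k → lookup (tagWord n (canon 1 L)) k ≡ shapeTag 1 L (suc (toℕ k))
  tag≡ = lookup-tagWord-canon n L
  first : ∀ k → toℕ k ≡ 0 →
    lookup (tagWord n (canon 1 L)) k ≡ 𝟎 ⊎ lookup (tagWord n (canon 1 L)) k ≡ S
  first k k≡0 = Sum.map (trans tag≡₁) (trans tag≡₁) (≢C⇒𝟎⊎S (shapeTag 1 L 1) (shapeTag-base≢C 1 L))
    where
    tag≡₁ : lookup (tagWord n (canon 1 L)) k ≡ shapeTag 1 L 1
    tag≡₁ = trans (tag≡ k) (cong (λ j → shapeTag 1 L (suc j)) k≡0)
  after-C : ∀ k k′ → toℕ k′ ≡ suc (toℕ k) → lookup (tagWord n (canon 1 L)) k′ ≡ C →
    lookup (tagWord n (canon 1 L)) k ≡ S ⊎ lookup (tagWord n (canon 1 L)) k ≡ C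
  after-C k k′ k′≡ C≡ =
    Sum.map (trans (tag≡ k)) (trans (tag≡ k)) (shapeTag-C⇒pred 1 L (suc (toℕ k)) C≡′)
    where
    C≡′ : shapeTag 1 L (suc (suc (toℕ k))) ≡ C
    C≡′ = trans (cong (λ j → shapeTag 1 L (suc j)) (sym k′≡)) (trans (sym (tag≡ k′)) C≡)

-- Tags determine the shape

SameTags : ℕ → ℕ → (ℕ → TagV) → (ℕ → TagV) → Set
SameTags n b f f′ = ∀ t → b ≤ t → t < n → f t ≡ f′ t

SameTags-sym : ∀ {n b f f′} → SameTags n b f f′ → SameTags n b f′ f
SameTags-sym same t b≤t t<n = sym (same t b≤t t<n)

empty-vs-block : ∀ n b g d L → All (_< n) (canon b ((g , d) ∷ L)) →
  ¬ SameTags n b (shapeTag b []) (shapeTag b ((g , d) ∷ L))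
empty-vs-block n b g d L bounded same with () ←
  trans (same (b + g) (m≤m+n b g) (All.lookup bounded (bottom∈canon⁺ (b + g) d L)))
        (shapeTag⁺-bottom (b + g) d L)

shorter-gap : ∀ n b g d L g′ d′ L′ → g < g′ → All (_< n) (canon b ((g , d) ∷ L)) →
  ¬ SameTags n b (shapeTag b ((g , d) ∷ L)) (shapeTag b ((g′ , d′) ∷ L′))
shorter-gap n b g d L g′ d′ L′ g<g′ bounded same with () ← begin
  S                                 ≡⟨ shapeTag⁺-bottom (b + g) d L ⟨
  shapeTag⁺ (b + g) d L (b + g)     ≡⟨ same (b + g) (m≤m+n b g) (All.lookup bounded (bottom∈canon⁺ _ d L)) ⟩
  shapeTag⁺ (b + g′) d′ L′ (b + g)  ≡⟨ shapeTag⁺-below (b + g′) d′ L′ (b + g) (+-monoʳ-< b g<g′) ⟩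
  𝟎                                 ∎

shorter-block : ∀ n s d L d′ L′ → d < d′ → All (_< n) (canon⁺ s d′ L′) →
  ¬ SameTags n s (shapeTag⁺ s d L) (shapeTag⁺ s d′ L′)
shorter-block n s d L d′ L′ d<d′ bounded′ same = shapeTag-base≢C t L (begin
  shapeTag t L t      ≡⟨ shapeTag⁺-above s d L t ≤-refl ⟨
  shapeTag⁺ s d L t   ≡⟨ same t (≤-trans (m≤m+n s d) (n≤1+n (s + d)))
                              (≤-<-trans t≤ (All.lookup bounded′ (top∈canon⁺ s d′ L′))) ⟩
  shapeTag⁺ s d′ L′ t ≡⟨ shapeTag⁺-inside s d′ L′ t (s≤s (m≤m+n s d)) t≤ ⟩
  C                   ∎)
  where
  t : ℕ
  t = suc (s + d)
  t≤ : t ≤ s + d′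
  t≤ = subst (_≤ s + d′) (+-suc s d) (+-monoʳ-≤ s d<d′)

mutual
  shapeTag-injective : ∀ n b L L′ → All (_< n) (canon b L) → All (_< n) (canon b L′) →
    SameTags n b (shapeTag b L) (shapeTag b L′) → L ≡ L′
  shapeTag-injective n b []            []              _       _        _    = refl
  shapeTag-injective n b []            ((g′ , d′) ∷ L′) _       bounded′ same =
    ⊥-elim (empty-vs-block n b g′ d′ L′ bounded′ same)
  shapeTag-injective n b ((g , d) ∷ L) []              bounded _        same =
    ⊥-elim (empty-vs-block n b g d L bounded (SameTags-sym same))
  shapeTag-injective n b ((g , d) ∷ L) ((g′ , d′) ∷ L′) bounded bounded′ same with <-cmp g g′
  ... | tri< g<g′ _ _ = ⊥-elim (shorter-gap n b g d L g′ d′ L′ g<g′ bounded same)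
  ... | tri> _ _ g′<g = ⊥-elim (shorter-gap n b g′ d′ L′ g d L g′<g bounded′ (SameTags-sym same))
  ... | tri≈ _ refl _ = cong (λ (d , L) → (g , d) ∷ L)
    (shapeTag⁺-injective n (b + g) d L d′ L′ bounded bounded′ (λ t s≤t → same t (≤-trans (m≤m+n b g) s≤t)))

  shapeTag⁺-injective : ∀ n s d L d′ L′ → All (_< n) (canon⁺ s d L) → All (_< n) (canon⁺ s d′ L′) →
    SameTags n s (shapeTag⁺ s d L) (shapeTag⁺ s d′ L′) → (d , L) ≡ (d′ , L′)
  shapeTag⁺-injective n s d L d′ L′ bounded bounded′ same with <-cmp d d′
  ... | tri< d<d′ _ _ = ⊥-elim (shorter-block n s d L d′ L′ d<d′ bounded′ same)
  ... | tri> _ _ d′<d = ⊥-elim (shorter-block n s d′ L′ d L d′<d bounded (SameTags-sym same))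
  ... | tri≈ _ refl _ = cong (d ,_)
    (shapeTag-injective n t L L′ (++⁻ʳ (block s d) bounded) (++⁻ʳ (block s d) bounded′) same-rest)
    where
    t : ℕ
    t = suc (s + d)
    same-rest : SameTags n t (shapeTag t L) (shapeTag t L′)
    same-rest u t≤u u<n = begin
      shapeTag t L u      ≡⟨ shapeTag⁺-above s d L u t≤u ⟨
      shapeTag⁺ s d L u   ≡⟨ same u (≤-trans (m≤m+n s d) (<⇒≤ t≤u)) u<n ⟩
      shapeTag⁺ s d L′ u  ≡⟨ shapeTag⁺-above s d L′ u t≤u ⟩
      shapeTag t L′ u     ∎

tagWord-≡⇒SameTags : ∀ n L L′ → tagWord n (canon 1 L) ≡ tagWord n (canon 1 L′) →
  SameTags n 1 (shapeTag 1 L) (shapeTag 1 L′)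
tagWord-≡⇒SameTags (suc n) L L′ tags≡ (suc t) _ 1+t<1+n = begin
  shapeTag 1 L (suc t)                    ≡⟨ cong (λ j → shapeTag 1 L (suc j)) (toℕ-fromℕ< t<n) ⟨
  shapeTag 1 L (suc (toℕ k))              ≡⟨ lookup-tagWord-canon (suc n) L k ⟨
  lookup (tagWord (suc n) (canon 1 L)) k  ≡⟨ cong (λ T → lookup T k) tags≡ ⟩
  lookup (tagWord (suc n) (canon 1 L′)) k ≡⟨ lookup-tagWord-canon (suc n) L′ k ⟩
  shapeTag 1 L′ (suc (toℕ k))             ≡⟨ cong (λ j → shapeTag 1 L′ (suc j)) (toℕ-fromℕ< t<n) ⟩
  shapeTag 1 L′ (suc t)                   ∎
  where
  t<n : t < n
  t<n = s≤s⁻¹ 1+t<1+n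
  k : Fin n
  k = fromℕ< t<n

-- Decoding tag words

widenGap : Shape → Shape
widenGap []            = []
widenGap ((g , d) ∷ L) = (suc g , d) ∷ L

shapeTag-widenGap : ∀ b L t → shapeTag b (widenGap L) t ≡ shapeTag (suc b) L t
shapeTag-widenGap b []            t = refl
shapeTag-widenGap b ((g , d) ∷ L) t = cong (λ s → shapeTag⁺ s d L t) (+-suc b g)

canon-widenGap : ∀ b L → canon b (widenGap L) ≡ canon (suc b) L
canon-widenGap b []            = refl
canon-widenGap b ((g , d) ∷ L) = cong (λ s → canon⁺ s d L) (+-suc b g)

leadingC : ∀ {m} → Vec TagV m → ℕ
leadingC (C ∷ T) = suc (leadingC T)
leadingC _       = 0

leadingC-C : ∀ {m} (T : Vec TagV m) k → toℕ k < leadingC T → lookup T k ≡ C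
leadingC-C (C ∷ T) Fin.zero    _   = refl
leadingC-C (C ∷ T) (Fin.suc k) k<c = leadingC-C T k (s≤s⁻¹ k<c)

leadingC-≤ : ∀ {m} (T : Vec TagV m) → leadingC T ≤ m
leadingC-≤ []      = z≤n
leadingC-≤ (C ∷ T) = s≤s (leadingC-≤ T)
leadingC-≤ (S ∷ T) = z≤n
leadingC-≤ (𝟎 ∷ T) = z≤n

-- The condition of 𝒯 as a chain: a C must follow a present letter, where s_0 counts as absent.
Admissible : ∀ {m} → TagV → Vec TagV m → Set
Admissible p []      = ⊤
Admissible p (x ∷ T) = (x ≡ C → p ≢ 𝟎) × Admissible x T

leadingC-after-𝟎 : ∀ {m} (T : Vec TagV m) → Admissible 𝟎 T → leadingC T ≡ 0
leadingC-after-𝟎 []      _               = refl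
leadingC-after-𝟎 (C ∷ T) (C⇒≢𝟎 , _) = ⊥-elim (C⇒≢𝟎 refl refl)
leadingC-after-𝟎 (S ∷ T) _               = refl
leadingC-after-𝟎 (𝟎 ∷ T) _               = refl

-- decode T is read with T starting at some base letter b: its leading C's belong to
-- a block opened further left, and decode T is the shape of the rest, based at b + leadingC T.
decode : ∀ {m} → Vec TagV m → Shape
decode []      = []
decode (𝟎 ∷ T) = widenGap (decode T)
decode (S ∷ T) = (0 , leadingC T) ∷ decode T
decode (C ∷ T) = decode T

+-identityʳ² : ∀ b → b + 0 + 0 ≡ b
+-identityʳ² b = trans (+-identityʳ (b + 0)) (+-identityʳ b)

decode-tags : ∀ {m} p (T : Vec TagV m) b → Admissible p T → ∀ k → leadingC T ≤ toℕ k →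
  shapeTag (b + leadingC T) (decode T) (b + toℕ k) ≡ lookup T k
decode-tags p (C ∷ T) b (_ , adm) (Fin.suc k) (s≤s c≤k) =
  subst₂ (λ x y → shapeTag x (decode T) y ≡ lookup T k) (sym (+-suc b (leadingC T))) (sym (+-suc b (toℕ k)))
    (decode-tags C T (suc b) adm k c≤k)
decode-tags p (S ∷ T) b (_ , adm) k _ =
  trans (cong (λ s → shapeTag⁺ s c L (b + toℕ k)) (+-identityʳ² b)) (tag-in-S-block k)
  where
  c : ℕ
  c = leadingC T
  L : Shape
  L = decode T
  tag-in-S-block : ∀ k → shapeTag⁺ b c L (b + toℕ k) ≡ lookup (S ∷ T) k
  tag-in-S-block Fin.zero = subst (λ t → shapeTag⁺ b c L t ≡ S) (sym (+-identityʳ b)) (shapeTag⁺-bottom b c L)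
  tag-in-S-block (Fin.suc k) with <-≤-connex (toℕ k) c
  ... | inj₁ k<c = trans (shapeTag⁺-inside b c L (b + suc (toℕ k)) (m<m+n b (s≤s z≤n)) (+-monoʳ-≤ b k<c))
                         (sym (leadingC-C T k k<c))
  ... | inj₂ c≤k = begin
    shapeTag⁺ b c L (b + suc (toℕ k))        ≡⟨ shapeTag⁺-above b c L _ (+-monoʳ-< b (s≤s c≤k)) ⟩
    shapeTag (suc b + c) L (b + suc (toℕ k)) ≡⟨ cong (shapeTag (suc b + c) L) (+-suc b (toℕ k)) ⟩
    shapeTag (suc b + c) L (suc b + toℕ k)   ≡⟨ decode-tags S T (suc b) adm k c≤k ⟩
    lookup T k                               ∎
decode-tags p (𝟎 ∷ T) b (_ , adm) k _ =
  trans (shapeTag-widenGap (b + 0) (decode T) (b + toℕ k)) (tag-after-𝟎 k)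
  where
  L : Shape
  L = decode T
  c≡0 : leadingC T ≡ 0
  c≡0 = leadingC-after-𝟎 T adm
  tag-after-𝟎 : ∀ k → shapeTag (suc b + 0) L (b + toℕ k) ≡ lookup (𝟎 ∷ T) k
  tag-after-𝟎 Fin.zero    = shapeTag-below (suc b + 0) L (b + 0) (n<1+n (b + 0))
  tag-after-𝟎 (Fin.suc k) = begin
    shapeTag (suc b + 0) L (b + suc (toℕ k))          ≡⟨ cong (shapeTag (suc b + 0) L) (+-suc b (toℕ k)) ⟩
    shapeTag (suc b + 0) L (suc b + toℕ k)            ≡⟨ cong (λ c → shapeTag (suc b + c) L (suc b + toℕ k)) c≡0 ⟨
    shapeTag (suc b + leadingC T) L (suc b + toℕ k)   ≡⟨ decode-tags 𝟎 T (suc b) adm k c≤k ⟩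
    lookup T k                                        ∎
    where
    c≤k : leadingC T ≤ toℕ k
    c≤k = subst (_≤ toℕ k) (sym c≡0) z≤n

decode-bounded : ∀ {m} p (T : Vec TagV m) b → Admissible p T → All (_< b + m) (canon (b + leadingC T) (decode T))
decode-bounded p []      b _         = []
decode-bounded {suc m} p (C ∷ T) b (_ , adm) =
  subst₂ (λ x y → All (_< y) (canon x (decode T))) (sym (+-suc b (leadingC T))) (sym (+-suc b m))
    (decode-bounded C T (suc b) adm)
decode-bounded {suc m} p (S ∷ T) b (_ , adm) =
  subst (λ s → All (_< b + suc m) (canon⁺ s (leadingC T) (decode T))) (sym (+-identityʳ² b))
    (All-++⁺ (block-all _ b (leadingC T) (λ _ _ t≤ → ≤-<-trans t≤ (+-monoʳ-< b (s≤s (leadingC-≤ T)))))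
         (subst (λ y → All (_< y) (canon (suc b + leadingC T) (decode T))) (sym (+-suc b m))
                (decode-bounded S T (suc b) adm)))
decode-bounded {suc m} p (𝟎 ∷ T) b (_ , adm) =
  subst (All (_< b + suc m)) (sym (canon-widenGap (b + 0) (decode T)))
    (subst₂ (λ x y → All (_< y) (canon (suc b + x) (decode T))) (leadingC-after-𝟎 T adm) (sym (+-suc b m))
            (decode-bounded 𝟎 T (suc b) adm))

𝟎⊎S⇒≢C : ∀ {x} → x ≡ 𝟎 ⊎ x ≡ S → x ≢ C
𝟎⊎S⇒≢C (inj₁ refl) ()
𝟎⊎S⇒≢C (inj₂ refl) ()

S⊎C⇒≢𝟎 : ∀ {x} → x ≡ S ⊎ x ≡ C → x ≢ 𝟎
S⊎C⇒≢𝟎 (inj₁ refl) ()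
S⊎C⇒≢𝟎 (inj₂ refl) ()

C-follows-present⇒Admissible : ∀ {m} p (T : Vec TagV m) →
  (∀ (k k′ : Fin (suc m)) → toℕ k′ ≡ suc (toℕ k) → lookup (p ∷ T) k′ ≡ C →
     lookup (p ∷ T) k ≡ S ⊎ lookup (p ∷ T) k ≡ C) →
  Admissible p T
C-follows-present⇒Admissible p []      _       = tt
C-follows-present⇒Admissible p (x ∷ T) after-C =
  (λ x≡C → S⊎C⇒≢𝟎 (after-C Fin.zero (Fin.suc Fin.zero) refl x≡C)) ,
  C-follows-present⇒Admissible x T (λ k k′ k′≡ → after-C (Fin.suc k) (Fin.suc k′) (cong suc k′≡))

InT⇒Admissible : ∀ {m} (T : Vec TagV m) → InT m T → Admissible 𝟎 T
InT⇒Admissible []      _                 = tt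
InT⇒Admissible (x ∷ T) (first , after-C) =
  (λ x≡C _ → 𝟎⊎S⇒≢C (first Fin.zero refl) x≡C) , C-follows-present⇒Admissible x T after-C

Tag-into-𝒯 : ∀ n w → Boolean n w → Σ (Vec TagV (n ∸ 1)) λ T → TagOf n w T × InT (n ∸ 1) T
Tag-into-𝒯 n w boolean with L , lexMin ← Boolean⇒lexMin-canon n w boolean =
  tagWord n (canon 1 L) , (canon 1 L , lexMin , refl) , tagWord-canon-∈𝒯 n L

Tag-injective : ∀ n (w w′ : Vec (Fin n) n) T →
  Boolean n w → Boolean n w′ → TagOf n w T → TagOf n w′ T → w ≡ w′
Tag-injective n w w′ T boolean boolean′ (u , u-lexMin , u↦T) (u′ , u′-lexMin , u′↦T)
  with L  , lexMin  ← Boolean⇒lexMin-canon n w boolean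
  with L′ , lexMin′ ← Boolean⇒lexMin-canon n w′ boolean′
  with ((valid  , L↦w)  , _) , _ ← lexMin
  with ((valid′ , L′↦w′) , _) , _ ← lexMin′ = begin
    w                      ≡⟨ L↦w ⟨
    prod n (canon 1 L)     ≡⟨ cong (prod n ∘ canon 1) L≡L′ ⟩
    prod n (canon 1 L′)    ≡⟨ L′↦w′ ⟩
    w′                     ∎
  where
  tags≡ : tagWord n (canon 1 L) ≡ tagWord n (canon 1 L′)
  tags≡ = begin
    tagWord n (canon 1 L)  ≡⟨ cong (tagWord n) (LexMinReduced-unique n w u _ u-lexMin lexMin) ⟨
    tagWord n u            ≡⟨ trans u↦T (sym u′↦T) ⟩
    tagWord n u′           ≡⟨ cong (tagWord n) (LexMinReduced-unique n w′ u′ _ u′-lexMin lexMin′) ⟩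
    tagWord n (canon 1 L′) ∎
  L≡L′ : L ≡ L′
  L≡L′ = shapeTag-injective n 1 L L′ (All.map proj₂ valid) (All.map proj₂ valid′)
           (tagWord-≡⇒SameTags n L L′ tags≡)

Tag-surjective : ∀ n (T : Vec TagV n) → InT n T →
  Σ (Vec (Fin (suc n)) (suc n)) λ w → Boolean (suc n) w × TagOf (suc n) w T
Tag-surjective n T inT =
  prod (suc n) (canon 1 L) , (canon 1 L , proj₁ lexMin , canon-unique 1 L) , (canon 1 L , lexMin , tags≡)
  where
  admissible : Admissible 𝟎 T
  admissible = InT⇒Admissible T inT
  c≡0 : leadingC T ≡ 0
  c≡0 = leadingC-after-𝟎 T admissible
  L : Shape
  L = decode T
  bounded : All (_< suc n) (canon 1 L)
  bounded = subst (λ c → All (_< suc n) (canon (suc c) L)) c≡0 (decode-bounded 𝟎 T 1 admissible)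
  lexMin : LexMinReduced (suc n) (prod (suc n) (canon 1 L)) (canon 1 L)
  lexMin = canon-LexMinReduced (suc n) L (All.tabulate (λ t∈ → canon-≥ 1 L t∈ , All.lookup bounded t∈))
  tag≡ : ∀ k → tagAt (suc (toℕ k)) (canon 1 L) ≡ lookup T k
  tag≡ k = trans (tagAt-canon 1 L (suc (toℕ k)))
    (subst (λ c → shapeTag (suc c) L (suc (toℕ k)) ≡ lookup T k) c≡0
           (decode-tags 𝟎 T 1 admissible k (subst (_≤ toℕ k) (sym c≡0) z≤n)))
  tags≡ : tagWord (suc n) (canon 1 L) ≡ T
  tags≡ = trans (tabulate-cong tag≡) (tabulate∘lookup T)

lemma5p3 : (n : ℕ) → 2 ≤ n →
  -- Tag is a well-defined map from B_n into 𝒯_{n-1}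
  ((w : Vec (Fin n) n) → Boolean n w →
     Σ (Vec TagV (n ∸ 1)) λ T → TagOf n w T × InT (n ∸ 1) T)
  -- injective on B_n
  × ((w w′ : Vec (Fin n) n) (T : Vec TagV (n ∸ 1)) →
     Boolean n w → Boolean n w′ → TagOf n w T → TagOf n w′ T → w ≡ w′)
  -- onto 𝒯_{n-1}
  × ((T : Vec TagV (n ∸ 1)) → InT (n ∸ 1) T →
     Σ (Vec (Fin n) n) λ w → Boolean n w × TagOf n w T)
lemma5p3 zero    ()
lemma5p3 (suc n) _ = Tag-into-𝒯 (suc n) , Tag-injective (suc n) , Tag-surjective n
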